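{- Let $G=(V,E)$ be a finite simple graph and $\{u,v\}\in E$. For all $x,y\in V$, $\mathrm{pm}_{G[uv]}(x,y)=\mathrm{pm}_G(x,y,u,v)$.
   Context: $x\sim_H y$ holds iff $\{x,y\}\in E(H)$ or $x=y$. For an even $m\ge0$ and (not necessarily distinct) vertices $w_1,\dots,w_m$, $\mathrm{pm}_H(w_1,\dots,w_m)=\bigoplus_P\bigwedge_{\{i,j\}\in P}(w_i\sim_H w_j)$, $P$ ranging over partitions of $\{1,\dots,m\}$ into 2-element sets ($\oplus$ = exclusive or; value true for $m=0$); in particular $\mathrm{pm}_H(x,y)=(x\sim_H y)$. Pivot: with $N'(x)=N(x)\cup\{x\}$, $V_1=N'(u)\setminus N'(v)$, $V_2=N'(v)\setminus N'(u)$, $V_3=N'(u)\cap N'(v)$, the graph $G[uv]$ is obtained from $G$ by toggling every pair $\{x,y\}$ with $x\in V_i$, $y\in V_j$, $i\neq j$. -}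

module Defs where

open import Data.Nat using (ℕ; zero; suc)
open import Data.Fin using (Fin; _≟_)
open import Data.Bool using (Bool; true; false; _∧_; _∨_; not; _xor_; if_then_else_)
open import Data.List using (List; foldr) renaming (concat to concatL)
import Data.List as List
open import Data.Vec using (Vec; []; _∷_)
import Data.Vec as Vec
open import Data.Product using (_×_; _,_)
open import Relation.Nullary.Decidable using (⌊_⌋)
open import Relation.Binary.PropositionalEquality using (_≡_; refl; sym; trans; cong₂)

record Graph (n : ℕ) : Set where
  field
    adj     : Fin n → Fin n → Bool
    adj-sym : ∀ x y → adj x y ≡ adj y x
    adj-irr : ∀ x → adj x x ≡ false
open Graph public

_∼[_]_ : ∀ {n} → Fin n → Graph n → Fin n → Bool
x ∼[ H ] y = ⌊ x ≟ y ⌋ ∨ adj H x y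

picks : ∀ {A : Set} {m} → Vec A (suc m) → List (A × Vec A m)
picks (x ∷ []) = (x , []) List.∷ List.[]
picks (x ∷ xs@(_ ∷ _)) = (x , xs) List.∷ List.map (λ { (y , r) → (y , x ∷ r) }) (picks xs)

-- all partitions of the positions {1,…,m} into 2-element sets, each block
-- recorded by the pair of entries at its two positions; the block containing
-- the first position is listed first (so each partition occurs exactly once).
pairings : ∀ {A : Set} {m} → Vec A m → List (List (A × A))
pairings {m = zero} [] = List.[] List.∷ List.[]
pairings {m = suc zero} (x ∷ []) = List.[]
pairings {m = suc (suc m)} (x ∷ xs) =
  concatL (List.map (λ { (y , r) → List.map ((x , y) List.∷_) (pairings {m = m} r) }) (picks xs))

allL : ∀ {A : Set} → (A → Bool) → List A → Bool
allL p = foldr (λ a b → p a ∧ b) true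

-- pm_H(w_1,…,w_m) = XOR over pairings P of AND over blocks {i,j} of (w_i ∼_H w_j)
-- (empty XOR = false, so odd m gives false; m = 0 gives true)
pm : ∀ {n} → Graph n → List (Fin n) → Bool
pm H ws = foldr _xor_ false
  (List.map (allL (λ { (a , b) → a ∼[ H ] b })) (pairings (Vec.fromList ws)))

data Part : Set where
  V₁ V₂ V₃ none : Part

part : ∀ {n} → Graph n → Fin n → Fin n → Fin n → Part
part G u v x with u ∼[ G ] x | v ∼[ G ] x
... | true  | false = V₁
... | false | true  = V₂
... | true  | true  = V₃
... | false | false = none

distinctParts : Part → Part → Bool
distinctParts V₁ V₂ = true
distinctParts V₁ V₃ = true
distinctParts V₂ V₁ = true
distinctParts V₂ V₃ = true
distinctParts V₃ V₁ = true
distinctParts V₃ V₂ = true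
distinctParts _  _  = false

distinctParts-sym : ∀ p q → distinctParts p q ≡ distinctParts q p
distinctParts-sym V₁ V₁ = refl
distinctParts-sym V₁ V₂ = refl
distinctParts-sym V₁ V₃ = refl
distinctParts-sym V₁ none = refl
distinctParts-sym V₂ V₁ = refl
distinctParts-sym V₂ V₂ = refl
distinctParts-sym V₂ V₃ = refl
distinctParts-sym V₂ none = refl
distinctParts-sym V₃ V₁ = refl
distinctParts-sym V₃ V₂ = refl
distinctParts-sym V₃ V₃ = refl
distinctParts-sym V₃ none = refl
distinctParts-sym none V₁ = refl
distinctParts-sym none V₂ = refl
distinctParts-sym none V₃ = refl
distinctParts-sym none none = refl

distinctParts-irr : ∀ p → distinctParts p p ≡ false
distinctParts-irr V₁ = refl
distinctParts-irr V₂ = refl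
distinctParts-irr V₃ = refl
distinctParts-irr none = refl

pivotAdj : ∀ {n} → Graph n → Fin n → Fin n → Fin n → Fin n → Bool
pivotAdj G u v x y = adj G x y xor distinctParts (part G u v x) (part G u v y)

pivot : ∀ {n} → Graph n → Fin n → Fin n → Graph n
pivot G u v = record
  { adj     = pivotAdj G u v
  ; adj-sym = λ x y → cong₂ _xor_ (adj-sym G x y)
                (distinctParts-sym (part G u v x) (part G u v y))
  ; adj-irr = λ x → trans (cong₂ _xor_ (adj-irr G x) (distinctParts-irr (part G u v x))) refl
  }

syntax pivot G u v = G [ u ∙ v ]

module Submission where

-- Write a ∼ b for a ∼_G b.  Expanding the three pairings of
-- (x, y, u, v) and using u ∼ v (as {u,v} is an edge),
--   pm_G(x,y,u,v) = (x ∼ y) ⊕ (x ∼ u ∧ y ∼ v) ⊕ (x ∼ v ∧ y ∼ u),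
-- while pm_{G[uv]}(x,y) is just x ∼_{G[uv]} y.  The pivot toggles {x,y}
-- exactly when x, y lie in different classes among V₁, V₂, V₃; encoding the
-- class of x by the pair (u ∼ x, v ∼ x), a check of all 16 cases gives
--   "x, y in different classes" = (u ∼ x ∧ v ∼ y) ⊕ (v ∼ x ∧ u ∼ y).
-- Hence for x ≠ y both sides equal adj(x,y) ⊕ (u ∼ x ∧ v ∼ y) ⊕ (v ∼ x ∧ u ∼ y),
-- and for x = y both sides are true, the two mixed terms cancelling.

open import Defs
open import Data.Fin using (Fin; _≟_)
open import Data.Bool using (Bool; true; false; _∧_; _∨_; _xor_)
open import Data.Bool.Properties
  using (∧-identityʳ; ∧-comm; ∨-zeroʳ; xor-identityʳ; xor-same)
open import Data.List using ([]; _∷_)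
open import Relation.Nullary using (yes; no; contradiction)
open import Relation.Nullary.Decidable using (⌊_⌋; toSum)
open import Data.Sum using (inj₁; inj₂)
open import Relation.Binary.PropositionalEquality
  using (_≡_; _≢_; refl; sym; cong; cong₂; module ≡-Reasoning)
open ≡-Reasoning

pm-pair : ∀ {n} (H : Graph n) (x y : Fin n) → pm H (x ∷ y ∷ []) ≡ x ∼[ H ] y
pm-pair H x y = begin
  (x ∼[ H ] y ∧ true) xor false ≡⟨ xor-identityʳ _ ⟩
  x ∼[ H ] y ∧ true             ≡⟨ ∧-identityʳ _ ⟩
  x ∼[ H ] y                    ∎

pm-quad : ∀ {n} (H : Graph n) (a b c d : Fin n) →
  pm H (a ∷ b ∷ c ∷ d ∷ []) ≡
    (a ∼[ H ] b ∧ c ∼[ H ] d) xor (a ∼[ H ] c ∧ b ∼[ H ] d)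
      xor (a ∼[ H ] d ∧ b ∼[ H ] c)
pm-quad H a b c d =
  cong₂ _xor_ (block a b c d)
    (cong₂ _xor_ (block a c b d)
      (begin
        (a ∼[ H ] d ∧ b ∼[ H ] c ∧ true) xor false ≡⟨ xor-identityʳ _ ⟩
        a ∼[ H ] d ∧ b ∼[ H ] c ∧ true             ≡⟨ block a d b c ⟩
        a ∼[ H ] d ∧ b ∼[ H ] c                    ∎))
  where
    block : ∀ p q r s → (p ∼[ H ] q ∧ r ∼[ H ] s ∧ true) ≡ (p ∼[ H ] q ∧ r ∼[ H ] s)
    block p q r s = cong (p ∼[ H ] q ∧_) (∧-identityʳ _)

∼-refl : ∀ {n} (H : Graph n) (x : Fin n) → x ∼[ H ] x ≡ true
∼-refl H x with x ≟ x
... | yes _   = refl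
... | no x≢x = contradiction refl x≢x

∼-distinct : ∀ {n} (H : Graph n) {x y : Fin n} → x ≢ y → x ∼[ H ] y ≡ adj H x y
∼-distinct H {x} {y} x≢y with x ≟ y
... | yes x≡y = contradiction x≡y x≢y
... | no _    = refl

∼-edge : ∀ {n} (H : Graph n) {x y : Fin n} → adj H x y ≡ true → x ∼[ H ] y ≡ true
∼-edge H {x} {y} xy = begin
  ⌊ x ≟ y ⌋ ∨ adj H x y ≡⟨ cong (⌊ x ≟ y ⌋ ∨_) xy ⟩
  ⌊ x ≟ y ⌋ ∨ true      ≡⟨ ∨-zeroʳ ⌊ x ≟ y ⌋ ⟩
  true                  ∎

∼-sym : ∀ {n} (H : Graph n) (x y : Fin n) → x ∼[ H ] y ≡ y ∼[ H ] x
∼-sym H x y with x ≟ y | y ≟ x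
... | yes _   | yes _   = refl
... | no _    | no _    = adj-sym H x y
... | yes x≡y | no y≢x = contradiction (sym x≡y) y≢x
... | no x≢y  | yes y≡x = contradiction (sym y≡x) x≢y

classOf : Bool → Bool → Part
classOf true  false = V₁
classOf false true  = V₂
classOf true  true  = V₃
classOf false false = none

part≡classOf : ∀ {n} (G : Graph n) (u v x : Fin n) →
  part G u v x ≡ classOf (u ∼[ G ] x) (v ∼[ G ] x)
part≡classOf G u v x with u ∼[ G ] x | v ∼[ G ] x
... | true  | false = refl
... | false | true  = refl
... | true  | true  = refl
... | false | false = refl

distinctParts-classOf : ∀ a b c d →
  distinctParts (classOf a b) (classOf c d) ≡ (a ∧ d) xor (b ∧ c)
distinctParts-classOf true  true  true  true  = refl
distinctParts-classOf true  true  true  false = refl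
distinctParts-classOf true  true  false true  = refl
distinctParts-classOf true  true  false false = refl
distinctParts-classOf true  false true  true  = refl
distinctParts-classOf true  false true  false = refl
distinctParts-classOf true  false false true  = refl
distinctParts-classOf true  false false false = refl
distinctParts-classOf false true  true  true  = refl
distinctParts-classOf false true  true  false = refl
distinctParts-classOf false true  false true  = refl
distinctParts-classOf false true  false false = refl
distinctParts-classOf false false c     d     = refl

pivotAdj-toggle : ∀ {n} (G : Graph n) (u v x y : Fin n) →
  pivotAdj G u v x y ≡
    adj G x y xor (u ∼[ G ] x ∧ v ∼[ G ] y) xor (v ∼[ G ] x ∧ u ∼[ G ] y)
pivotAdj-toggle G u v x y = begin
  adj G x y xor distinctParts (part G u v x) (part G u v y)
    ≡⟨ cong (adj G x y xor_)
         (cong₂ distinctParts (part≡classOf G u v x) (part≡classOf G u v y)) ⟩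
  adj G x y xor distinctParts (classOf (u ∼[ G ] x) (v ∼[ G ] x))
                              (classOf (u ∼[ G ] y) (v ∼[ G ] y))
    ≡⟨ cong (adj G x y xor_) (distinctParts-classOf _ _ _ _) ⟩
  adj G x y xor (u ∼[ G ] x ∧ v ∼[ G ] y) xor (v ∼[ G ] x ∧ u ∼[ G ] y) ∎

-- On an edge {u,v} the pairing {xy|uv} contributes x ∼ y, and the other two
-- are rewritten with u, v first, matching the toggle formula.
pm-quad-edge : ∀ {n} (G : Graph n) {u v : Fin n} → adj G u v ≡ true →
  ∀ (x y : Fin n) →
    pm G (x ∷ y ∷ u ∷ v ∷ []) ≡
      x ∼[ G ] y xor (u ∼[ G ] x ∧ v ∼[ G ] y) xor (v ∼[ G ] x ∧ u ∼[ G ] y)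
pm-quad-edge G {u} {v} uv x y = begin
  pm G (x ∷ y ∷ u ∷ v ∷ [])
    ≡⟨ pm-quad G x y u v ⟩
  (x ∼[ G ] y ∧ u ∼[ G ] v) xor (x ∼[ G ] u ∧ y ∼[ G ] v) xor (x ∼[ G ] v ∧ y ∼[ G ] u)
    ≡⟨ cong₂ _xor_ xy-term
         (cong₂ _xor_ (cong₂ _∧_ (∼-sym G x u) (∼-sym G y v))
                      (cong₂ _∧_ (∼-sym G x v) (∼-sym G y u))) ⟩
  x ∼[ G ] y xor (u ∼[ G ] x ∧ v ∼[ G ] y) xor (v ∼[ G ] x ∧ u ∼[ G ] y) ∎
  where
    xy-term : (x ∼[ G ] y ∧ u ∼[ G ] v) ≡ x ∼[ G ] y
    xy-term = begin
      x ∼[ G ] y ∧ u ∼[ G ] v ≡⟨ cong (x ∼[ G ] y ∧_) (∼-edge G uv) ⟩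
      x ∼[ G ] y ∧ true       ≡⟨ ∧-identityʳ _ ⟩
      x ∼[ G ] y              ∎

-- On the diagonal both sides are true: pivoting keeps x ∼ x, and in
-- pm_G(x,x,u,v) the two mixed pairings coincide and cancel.
pm-pivot-diagonal : ∀ {n} (G : Graph n) {u v : Fin n} → adj G u v ≡ true →
  ∀ (x : Fin n) → pm (pivot G u v) (x ∷ x ∷ []) ≡ pm G (x ∷ x ∷ u ∷ v ∷ [])
pm-pivot-diagonal G {u} {v} uv x = begin
  pm (pivot G u v) (x ∷ x ∷ [])  ≡⟨ pm-pair (pivot G u v) x x ⟩
  x ∼[ pivot G u v ] x           ≡⟨ ∼-refl (pivot G u v) x ⟩
  true                           ≡⟨ cong (true xor_) (xor-same ux∧vx) ⟨
  true xor ux∧vx xor ux∧vx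
    ≡⟨ cong₂ _xor_ (∼-refl G x) (cong (ux∧vx xor_) (∧-comm (v ∼[ G ] x) (u ∼[ G ] x))) ⟨
  x ∼[ G ] x xor ux∧vx xor (v ∼[ G ] x ∧ u ∼[ G ] x)
    ≡⟨ pm-quad-edge G uv x x ⟨
  pm G (x ∷ x ∷ u ∷ v ∷ [])      ∎
  where
    ux∧vx : Bool
    ux∧vx = u ∼[ G ] x ∧ v ∼[ G ] x

pm-pivot-off-diagonal : ∀ {n} (G : Graph n) {u v : Fin n} → adj G u v ≡ true →
  ∀ {x y : Fin n} → x ≢ y → pm (pivot G u v) (x ∷ y ∷ []) ≡ pm G (x ∷ y ∷ u ∷ v ∷ [])
pm-pivot-off-diagonal G {u} {v} uv {x} {y} x≢y = begin
  pm (pivot G u v) (x ∷ y ∷ [])  ≡⟨ pm-pair (pivot G u v) x y ⟩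
  x ∼[ pivot G u v ] y           ≡⟨ ∼-distinct (pivot G u v) x≢y ⟩
  pivotAdj G u v x y             ≡⟨ pivotAdj-toggle G u v x y ⟩
  adj G x y xor toggle           ≡⟨ cong (_xor toggle) (∼-distinct G x≢y) ⟨
  x ∼[ G ] y xor toggle          ≡⟨ pm-quad-edge G uv x y ⟨
  pm G (x ∷ y ∷ u ∷ v ∷ [])      ∎
  where
    toggle : Bool
    toggle = (u ∼[ G ] x ∧ v ∼[ G ] y) xor (v ∼[ G ] x ∧ u ∼[ G ] y)

lemma5 : ∀ {n} (G : Graph n) (u v : Fin n) → adj G u v ≡ true →
    ∀ (x y : Fin n) →
      pm (pivot G u v) (x ∷ y ∷ []) ≡ pm G (x ∷ y ∷ u ∷ v ∷ [])
lemma5 G u v uv x y with toSum (x ≟ y)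
... | inj₁ refl = pm-pivot-diagonal G uv x
... | inj₂ x≢y  = pm-pivot-off-diagonal G uv x≢y
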